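{- Let $q$ be a prime power and $s\ge 1$. If a set of $s$ mutually orthogoval Desarguesian projective planes of order $q$ exists, then there exists a $\mathrm{CPHF}_{s-1}(s;\,3,\,q^2+q+1,\,q)$. If a set of $s$ mutually orthogoval Desarguesian affine planes of order $q$ exists, then there exists an $\mathrm{SCPHF}_{s-1}(s;\,3,\,q^2,\,q)$.
   Context: Two planes, both projective or both affine, of the same order and on the same point set are orthogoval if every line of one meets every line of the other in at most two points; a set is mutually orthogoval if pairwise orthogoval. A covering perfect hash family $\mathrm{CPHF}_{\lambda}(n;t,k,q)$ is an $n\times k$ array with entries from $\mathbb{F}_q^t\setminus\{\vec 0\}$ such that for each set $T$ of $t$ columns there exist at least $\lambda$ rows whose entries in the columns of $T$ are linearly independent over $\mathbb{F}_q$; if all entries have nonzero last coordinate, it is a Sherwood covering perfect hash family $\mathrm{SCPHF}_{\lambda}(n;t,k,q)$. -}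

module Defs where

open import Level using (0ℓ)
open import Data.Nat using (ℕ; zero; suc; _∸_) renaming (_+_ to _+ℕ_; _*_ to _*ℕ_)
open import Data.Fin using (Fin; zero; suc; toℕ)
open import Data.Product using (Σ; _×_; _,_; ∃-syntax)
open import Relation.Binary.PropositionalEquality using (_≡_; _≢_)
open import Relation.Nullary using (¬_)
open import Algebra.Structures using (IsCommutativeRing)
open import Function.Bundles using (_↔_; Inverse)
open import Function.Definitions using (Injective)

record FiniteField (q : ℕ) : Set₁ where
  infixl 7 _*_
  infixl 6 _+_
  field
    Carrier : Set
    _+_ _*_ : Carrier → Carrier → Carrier
    -_      : Carrier → Carrier
    0# 1#   : Carrier
    isCommutativeRing : IsCommutativeRing _≡_ _+_ _*_ -_ 0# 1#
    0≢1     : 0# ≢ 1#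
    inverse : ∀ x → x ≢ 0# → Σ Carrier (λ y → x * y ≡ 1#)
    card    : Carrier ↔ Fin q

module _ {q : ℕ} (F : FiniteField q) where
  open FiniteField F

  Vecᶠ : ℕ → Set
  Vecᶠ t = Fin t → Carrier

  zeroVec : ∀ {t} → Vecᶠ t
  zeroVec _ = 0#

  Σᶠ : ∀ t → (Fin t → Carrier) → Carrier
  Σᶠ zero    f = 0#
  Σᶠ (suc t) f = f zero + Σᶠ t (λ i → f (suc i))

  dot : ∀ {t} → Vecᶠ t → Vecᶠ t → Carrier
  dot {t} a x = Σᶠ t (λ i → a i * x i)

  NonZeroVec : ∀ {t} → Vecᶠ t → Set
  NonZeroVec v = ¬ (∀ i → v i ≡ 0#)

  LinIndep : ∀ {m t} → (Fin m → Vecᶠ t) → Set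
  LinIndep {m} {t} v =
    (α : Fin m → Carrier) →
    (∀ j → Σᶠ m (λ i → α i * v i j) ≡ 0#) →
    ∀ i → α i ≡ 0#

  Array : ℕ → ℕ → ℕ → Set
  Array n k t = Fin n → Fin k → Vecᶠ t

  AtLeastRows : ∀ {n} → ℕ → (Fin n → Set) → Set
  AtLeastRows {n} λ' R =
    Σ (Fin λ' → Fin n) (λ f → Injective _≡_ _≡_ f × (∀ j → R (f j)))

  -- each set T of t columns = injective choice c : Fin t → Fin k
  IsCPHF : (λ' n t k : ℕ) → Array n k t → Set
  IsCPHF λ' n t k A =
    (∀ r c → NonZeroVec (A r c)) ×
    ((c : Fin t → Fin k) → Injective _≡_ _≡_ c →
       AtLeastRows λ' (λ r → LinIndep (λ i → A r (c i))))

  CPHF : (λ' n t k : ℕ) → Set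
  CPHF λ' n t k = Σ (Array n k t) (IsCPHF λ' n t k)

  SCPHF : (λ' n t k : ℕ) → Set
  SCPHF λ' n t k =
    Σ (Array n k t) (λ A → IsCPHF λ' n t k A ×
      (∀ r c (i : Fin t) → toℕ i ≡ t ∸ 1 → A r c i ≢ 0#))

  -- Desarguesian projective planes on a point set P: a plane isomorphic
  -- to PG(2,q), given by a coordinatisation φ : P → F³ \ {0} that is a
  -- bijection from P onto the projective points (1-dim subspaces).
  -- Its lines are the sets { x | a · φ x = 0 } for a ≠ 0.

  Proportional : ∀ {t} → Vecᶠ t → Vecᶠ t → Set
  Proportional u v = Σ Carrier (λ c → c ≢ 0# × (∀ i → u i ≡ c * v i))

  record DesarguesianProjPlane (P : Set) : Set where
    field
      coord      : P → Vecᶠ 3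
      nonzero    : ∀ x → NonZeroVec (coord x)
      injective  : ∀ x y → Proportional (coord x) (coord y) → x ≡ y
      surjective : ∀ v → NonZeroVec v → Σ P (λ x → Proportional v (coord x))

    OnLine : Vecᶠ 3 → P → Set
    OnLine a x = dot a (coord x) ≡ 0#

  open DesarguesianProjPlane

  OrthogovalProj : ∀ {P} → DesarguesianProjPlane P → DesarguesianProjPlane P → Set
  OrthogovalProj {P} π₁ π₂ =
    ∀ (a b : Vecᶠ 3) → NonZeroVec a → NonZeroVec b →
    ∀ (x y z : P) → x ≢ y → y ≢ z → x ≢ z →
    ¬ (OnLine π₁ a x × OnLine π₁ a y × OnLine π₁ a z ×
       OnLine π₂ b x × OnLine π₂ b y × OnLine π₂ b z)

  -- Desarguesian affine planes on P: a bijection φ : P ↔ F² (copy of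
  -- AG(2,q)); lines are the sets { x | a · φ x = c } with a ≠ 0.
  record DesarguesianAffPlane (P : Set) : Set where
    field
      affCoord : P ↔ Vecᶠ 2

    OnAffLine : Vecᶠ 2 → Carrier → P → Set
    OnAffLine a c x = dot a (Inverse.to affCoord x) ≡ c

  open DesarguesianAffPlane

  OrthogovalAff : ∀ {P} → DesarguesianAffPlane P → DesarguesianAffPlane P → Set
  OrthogovalAff {P} π₁ π₂ =
    ∀ (a b : Vecᶠ 2) (c d : Carrier) → NonZeroVec a → NonZeroVec b →
    ∀ (x y z : P) → x ≢ y → y ≢ z → x ≢ z →
    ¬ (OnAffLine π₁ a c x × OnAffLine π₁ a c y × OnAffLine π₁ a c z ×
       OnAffLine π₂ b d x × OnAffLine π₂ b d y × OnAffLine π₂ b d z)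

  -- a set of s mutually orthogoval planes (pairwise orthogoval; since
  -- orthogoval planes of order ≥ 2 are distinct, this is a set of s planes)
  MutOrthProj : ∀ {P} (s : ℕ) → (Fin s → DesarguesianProjPlane P) → Set
  MutOrthProj s π = ∀ i j → i ≢ j → OrthogovalProj (π i) (π j)

  MutOrthAff : ∀ {P} (s : ℕ) → (Fin s → DesarguesianAffPlane P) → Set
  MutOrthAff s π = ∀ i j → i ≢ j → OrthogovalAff (π i) (π j)

-- Each plane πᵣ gives a row, the points of π₀ (in some fixed enumeration) give the
-- columns, and the entry in row r and column x is the coordinate vector of x in πᵣ
-- (for an affine plane, (u, v) ↦ (u, v, 1)).  Three coordinate vectors are linearly
-- dependent exactly when their determinant vanishes, i.e. when the three points are
-- collinear in that plane.  Orthogovality forbids three distinct points from being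
-- collinear in two of the planes, so every triple of columns fails in at most one
-- row and the remaining s - 1 rows witness independence.

module Submission where

open import Defs
import Data.Nat as ℕ
open import Data.Nat using (ℕ; suc; _≥_; _∸_)
open import Data.Fin using (Fin; punchIn)
import Data.Fin as Fin
open import Data.Fin.Patterns using (0F; 1F; 2F)
open import Data.Fin.Properties using (punchIn-injective; punchInᵢ≢i; any?; all?; ¬∀⟶∃¬; +↔⊎; *↔×)
open import Data.Vec.Functional using ([]; _∷_)
open import Data.Product using (Σ-syntax; _×_; _,_; proj₁; proj₂)
open import Data.Sum using (inj₁; inj₂; _⊎_)
open import Data.Sum.Function.Propositional using (_⊎-↔_)
open import Data.Empty using (⊥; ⊥-elim)
open import Relation.Nullary using (¬_; Dec; yes; no)
open import Relation.Nullary.Decidable using (map′)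
open import Relation.Binary.Definitions using (DecidableEquality)
open import Relation.Binary.PropositionalEquality
open import Function.Base using (_∘′_)
open import Function.Bundles using (_↔_; Inverse; Injection)
open import Function.Definitions using (Injective)
open import Function.Properties.Inverse using (↔⇒↣; ↔-sym; ↔-trans; ↔-refl)
open import Algebra.Bundles using (CommutativeRing)

↔-to-injective : {A B : Set} (I : A ↔ B) → Injective _≡_ _≡_ (Inverse.to I)
↔-to-injective I = Injection.injective (↔⇒↣ I)

↔-from-injective : {A B : Set} (I : A ↔ B) → Injective _≡_ _≡_ (Inverse.from I)
↔-from-injective I = ↔-to-injective (↔-sym I)

allButAtMostOne : ∀ {n} {G B : Fin (suc n) → Set} →
  (∀ r → Dec (B r)) → (∀ r → ¬ B r → G r) → (∀ {r r′} → r ≢ r′ → B r → B r′ → ⊥) →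
  Σ[ f ∈ (Fin n → Fin (suc n)) ] Injective _≡_ _≡_ f × (∀ j → G (f j))
allButAtMostOne B? good unique with any? B?
... | yes (r , Br) = punchIn r , punchIn-injective r _ _ ,
      λ j → good (punchIn r j) (unique (λ e → punchInᵢ≢i r j (sym e)) Br)
... | no ¬∃B = punchIn 0F , punchIn-injective 0F _ _ ,
      λ j → good (punchIn 0F j) (λ Bj → ¬∃B (punchIn 0F j , Bj))

module _ {q : ℕ} (F : FiniteField q) where
  open FiniteField F
  open DesarguesianProjPlane using (coord; nonzero; injective; surjective; OnLine)
  open DesarguesianAffPlane using (affCoord)

  commutativeRing : CommutativeRing _ _
  commutativeRing = record { isCommutativeRing = isCommutativeRing }

  open CommutativeRing commutativeRing using (+-identityˡ; -‿inverseʳ; *-assoc; *-comm;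
    *-identityˡ; *-identityʳ; zeroˡ; zeroʳ; distribʳ; commutativeSemiring; +-abelianGroup; ring)
  open import Algebra.Properties.AbelianGroup +-abelianGroup using (x∙y⁻¹≈ε⇒x≈y; inverseˡ-unique; ⁻¹-∙-comm)
  open import Algebra.Properties.Ring ring using (-‿distribˡ-*)
  open import Algebra.Solver.Ring.NaturalCoefficients.Default commutativeSemiring

  V2 V3 : Set
  V2 = Vecᶠ F 2
  V3 = Vecᶠ F 3

  _≟_ : DecidableEquality Carrier
  x ≟ y = map′ (↔-to-injective card) (cong (Inverse.to card)) (Inverse.to card x Fin.≟ Inverse.to card y)

  x*y≡0⇒x≡0 : ∀ {x y} → y ≢ 0# → x * y ≡ 0# → x ≡ 0#
  x*y≡0⇒x≡0 {x} {y} y≢0 xy≡0 with inverse y y≢0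
  ... | (y⁻¹ , yy⁻¹≡1) = begin
      x               ≡⟨ sym (*-identityʳ x) ⟩
      x * 1#          ≡⟨ cong (x *_) (sym yy⁻¹≡1) ⟩
      x * (y * y⁻¹)   ≡⟨ sym (*-assoc x y y⁻¹) ⟩
      (x * y) * y⁻¹   ≡⟨ cong (_* y⁻¹) xy≡0 ⟩
      0# * y⁻¹        ≡⟨ zeroˡ y⁻¹ ⟩
      0#              ∎
    where open ≡-Reasoning

  x*y≡0⇒y≡0 : ∀ {x y} → x ≢ 0# → x * y ≡ 0# → y ≡ 0#
  x*y≡0⇒y≡0 {x} {y} x≢0 xy≡0 = x*y≡0⇒x≡0 x≢0 (trans (*-comm y x) xy≡0)

  x-y≡0⇒x≡y : ∀ {x y} → x + - y ≡ 0# → x ≡ y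
  x-y≡0⇒x≡y = x∙y⁻¹≈ε⇒x≈y _ _

  Σᶠ-zero : ∀ t {f : Fin t → Carrier} → (∀ i → f i ≡ 0#) → Σᶠ F t f ≡ 0#
  Σᶠ-zero ℕ.zero    f≡0 = refl
  Σᶠ-zero (ℕ.suc t) f≡0 = trans (cong₂ _+_ (f≡0 0F) (Σᶠ-zero t (λ i → f≡0 (Fin.suc i)))) (+-identityˡ 0#)

  Σᶠ-cong : ∀ t {f g : Fin t → Carrier} → (∀ i → f i ≡ g i) → Σᶠ F t f ≡ Σᶠ F t g
  Σᶠ-cong ℕ.zero    f≡g = refl
  Σᶠ-cong (ℕ.suc t) f≡g = cong₂ _+_ (f≡g 0F) (Σᶠ-cong t (λ i → f≡g (Fin.suc i)))

  dot-zeroʳ : ∀ {t} (a : Vecᶠ F t) {x : Vecᶠ F t} → (∀ i → x i ≡ 0#) → dot F a x ≡ 0#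
  dot-zeroʳ {t} a x≡0 = Σᶠ-zero t (λ i → trans (cong (a i *_) (x≡0 i)) (zeroʳ (a i)))

  dot-congʳ : ∀ {t} (a : Vecᶠ F t) {x y : Vecᶠ F t} → (∀ i → x i ≡ y i) → dot F a x ≡ dot F a y
  dot-congʳ {t} a x≡y = Σᶠ-cong t (λ i → cong (a i *_) (x≡y i))

  cross : V3 → V3 → V3
  cross u v 0F = u 1F * v 2F + - (u 2F * v 1F)
  cross u v 1F = u 2F * v 0F + - (u 0F * v 2F)
  cross u v 2F = u 0F * v 1F + - (u 1F * v 0F)

  det : V3 → V3 → V3 → Carrier
  det u v w = dot F (cross u v) w

  -- The even and odd permutation terms of the Leibniz formula: the identities about det
  -- below reduce to negation-free identities between them.
  detEven detOdd : V3 → V3 → V3 → Carrier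
  detEven u v w = u 1F * v 2F * w 0F + (u 2F * v 0F * w 1F + u 0F * v 1F * w 2F)
  detOdd  u v w = u 2F * v 1F * w 0F + (u 0F * v 2F * w 1F + u 1F * v 0F * w 2F)

  det≡detEven-detOdd : ∀ u v w → det u v w ≡ detEven u v w + - detOdd u v w
  det≡detEven-detOdd u v w = begin
      det u v w
        ≡⟨ cong₂ _+_ (sub-*ʳ (w 0F)) (cong₂ _+_ (sub-*ʳ (w 1F)) (cong (_+ 0#) (sub-*ʳ (w 2F)))) ⟩
      (_ + - _) + ((_ + - _) + ((_ + - _) + 0#))
        ≡⟨ regroup _ _ _ _ _ _ ⟩
      detEven u v w + (- _ + (- _ + - _))
        ≡⟨ cong (detEven u v w +_) (trans (cong (- _ +_) (⁻¹-∙-comm _ _)) (⁻¹-∙-comm _ _)) ⟩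
      detEven u v w + - detOdd u v w ∎
    where
    open ≡-Reasoning
    sub-*ʳ : ∀ {a b} c → (a + - b) * c ≡ a * c + - (b * c)
    sub-*ʳ {a} {b} c = trans (distribʳ c a (- b)) (cong (a * c +_) (sym (-‿distribˡ-* b c)))
    regroup : ∀ a a′ b b′ c c′ →
      (a + a′) + ((b + b′) + ((c + c′) + 0#)) ≡ (a + (b + c)) + (a′ + (b′ + c′))
    regroup = solve 6 (λ a a′ b b′ c c′ →
      (a :+ a′) :+ ((b :+ b′) :+ ((c :+ c′) :+ con 0)) := (a :+ (b :+ c)) :+ (a′ :+ (b′ :+ c′))) refl

  det≡0-fromHalves : ∀ u v w → detEven u v w ≡ detOdd u v w → det u v w ≡ 0#
  det≡0-fromHalves u v w even≡odd = begin
      det u v w                        ≡⟨ det≡detEven-detOdd u v w ⟩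
      detEven u v w + - detOdd u v w   ≡⟨ cong (_+ - detOdd u v w) even≡odd ⟩
      detOdd u v w + - detOdd u v w    ≡⟨ -‿inverseʳ (detOdd u v w) ⟩
      0#                               ∎
    where open ≡-Reasoning

  det-repeatˡ : ∀ u v → det u v u ≡ 0#
  det-repeatˡ u v = det≡0-fromHalves u v u (solve 6 (λ u₀ u₁ u₂ v₀ v₁ v₂ →
      u₁ :* v₂ :* u₀ :+ (u₂ :* v₀ :* u₁ :+ u₀ :* v₁ :* u₂) := u₂ :* v₁ :* u₀ :+ (u₀ :* v₂ :* u₁ :+ u₁ :* v₀ :* u₂))
    refl (u 0F) (u 1F) (u 2F) (v 0F) (v 1F) (v 2F))

  det-repeatʳ : ∀ u v → det u v v ≡ 0#
  det-repeatʳ u v = det≡0-fromHalves u v v (solve 6 (λ u₀ u₁ u₂ v₀ v₁ v₂ →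
      u₁ :* v₂ :* v₀ :+ (u₂ :* v₀ :* v₁ :+ u₀ :* v₁ :* v₂) := u₂ :* v₁ :* v₀ :+ (u₀ :* v₂ :* v₁ :+ u₁ :* v₀ :* v₂))
    refl (u 0F) (u 1F) (u 2F) (v 0F) (v 1F) (v 2F))

  det-rotate : ∀ u v w → det v w u ≡ det u v w
  det-rotate u v w = begin
      det v w u                        ≡⟨ det≡detEven-detOdd v w u ⟩
      detEven v w u + - detOdd v w u
        ≡⟨ cong₂ (λ e o → e + - o) (even (u 0F) (u 1F) (u 2F) (v 0F) (v 1F) (v 2F) (w 0F) (w 1F) (w 2F))
                                   (odd (u 0F) (u 1F) (u 2F) (v 0F) (v 1F) (v 2F) (w 0F) (w 1F) (w 2F)) ⟩
      detEven u v w + - detOdd u v w   ≡⟨ sym (det≡detEven-detOdd u v w) ⟩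
      det u v w                        ∎
    where
    open ≡-Reasoning
    even : ∀ u₀ u₁ u₂ v₀ v₁ v₂ w₀ w₁ w₂ →
      v₁ * w₂ * u₀ + (v₂ * w₀ * u₁ + v₀ * w₁ * u₂) ≡ u₁ * v₂ * w₀ + (u₂ * v₀ * w₁ + u₀ * v₁ * w₂)
    even = solve 9 (λ u₀ u₁ u₂ v₀ v₁ v₂ w₀ w₁ w₂ →
      v₁ :* w₂ :* u₀ :+ (v₂ :* w₀ :* u₁ :+ v₀ :* w₁ :* u₂) := u₁ :* v₂ :* w₀ :+ (u₂ :* v₀ :* w₁ :+ u₀ :* v₁ :* w₂)) refl
    odd : ∀ u₀ u₁ u₂ v₀ v₁ v₂ w₀ w₁ w₂ →
      v₂ * w₁ * u₀ + (v₀ * w₂ * u₁ + v₁ * w₀ * u₂) ≡ u₂ * v₁ * w₀ + (u₀ * v₂ * w₁ + u₁ * v₀ * w₂)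
    odd = solve 9 (λ u₀ u₁ u₂ v₀ v₁ v₂ w₀ w₁ w₂ →
      v₂ :* w₁ :* u₀ :+ (v₀ :* w₂ :* u₁ :+ v₁ :* w₀ :* u₂) := u₂ :* v₁ :* w₀ :+ (u₀ :* v₂ :* w₁ :+ u₁ :* v₀ :* w₂)) refl

  dot-linearʳ : ∀ (w : V3) (α : Fin 3 → Carrier) (v : Fin 3 → V3) →
    dot F w (λ j → Σᶠ F 3 (λ i → α i * v i j)) ≡ Σᶠ F 3 (λ i → α i * dot F w (v i))
  dot-linearʳ w α v = solve 15 (λ w₀ w₁ w₂ α₀ α₁ α₂ x₀ x₁ x₂ y₀ y₁ y₂ z₀ z₁ z₂ →
        w₀ :* (α₀ :* x₀ :+ (α₁ :* y₀ :+ (α₂ :* z₀ :+ con 0)))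
     :+ (w₁ :* (α₀ :* x₁ :+ (α₁ :* y₁ :+ (α₂ :* z₁ :+ con 0)))
     :+ (w₂ :* (α₀ :* x₂ :+ (α₁ :* y₂ :+ (α₂ :* z₂ :+ con 0))) :+ con 0))
     := α₀ :* (w₀ :* x₀ :+ (w₁ :* x₁ :+ (w₂ :* x₂ :+ con 0)))
     :+ (α₁ :* (w₀ :* y₀ :+ (w₁ :* y₁ :+ (w₂ :* y₂ :+ con 0)))
     :+ (α₂ :* (w₀ :* z₀ :+ (w₁ :* z₁ :+ (w₂ :* z₂ :+ con 0))) :+ con 0)))
    refl (w 0F) (w 1F) (w 2F) (α 0F) (α 1F) (α 2F)
         (v 0F 0F) (v 0F 1F) (v 0F 2F) (v 1F 0F) (v 1F 1F) (v 1F 2F) (v 2F 0F) (v 2F 1F) (v 2F 2F)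

  -- Pairing a vanishing combination with the cross product of two of the vectors
  -- isolates the coefficient of the third, multiplied by the determinant.
  det≢0⇒linIndep : (v : Fin 3 → V3) → det (v 0F) (v 1F) (v 2F) ≢ 0# → LinIndep F v
  det≢0⇒linIndep v det≢0 α αv≡0 = isolate
    where
    x = v 0F
    y = v 1F
    z = v 2F
    D = det x y z
    pairings : ∀ w {d₀ d₁ d₂} → dot F w x ≡ d₀ → dot F w y ≡ d₁ → dot F w z ≡ d₂ →
               α 0F * d₀ + (α 1F * d₁ + (α 2F * d₂ + 0#)) ≡ 0#
    pairings w refl refl refl = trans (sym (dot-linearʳ w α v)) (dot-zeroʳ w αv≡0)
    only₀ : ∀ a b c d → a * d + (b * 0# + (c * 0# + 0#)) ≡ a * d
    only₀ = solve 4 (λ a b c d → a :* d :+ (b :* con 0 :+ (c :* con 0 :+ con 0)) := a :* d) refl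
    only₁ : ∀ a b c d → a * 0# + (b * d + (c * 0# + 0#)) ≡ b * d
    only₁ = solve 4 (λ a b c d → a :* con 0 :+ (b :* d :+ (c :* con 0 :+ con 0)) := b :* d) refl
    only₂ : ∀ a b c d → a * 0# + (b * 0# + (c * d + 0#)) ≡ c * d
    only₂ = solve 4 (λ a b c d → a :* con 0 :+ (b :* con 0 :+ (c :* d :+ con 0)) := c :* d) refl
    isolate : ∀ i → α i ≡ 0#
    isolate 0F = x*y≡0⇒x≡0 det≢0 (trans (sym (only₀ _ _ _ D)) (pairings (cross y z)
      (det-rotate x y z) (det-repeatˡ y z) (det-repeatʳ y z)))
    isolate 1F = x*y≡0⇒x≡0 det≢0 (trans (sym (only₁ _ _ _ D)) (pairings (cross z x)
      (det-repeatʳ z x) (trans (det-rotate y z x) (det-rotate x y z)) (det-repeatˡ z x)))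
    isolate 2F = x*y≡0⇒x≡0 det≢0 (trans (sym (only₂ _ _ _ D)) (pairings (cross x y)
      (det-repeatˡ x y) (det-repeatʳ x y) refl))

  Proportional-sym : ∀ {t} {u v : Vecᶠ F t} → Proportional F u v → Proportional F v u
  Proportional-sym {v = v} (c , c≢0 , u≡cv) with inverse c c≢0
  ... | (c⁻¹ , cc⁻¹≡1) = c⁻¹ , c⁻¹≢0 , λ i → sym (begin
      c⁻¹ * _          ≡⟨ cong (c⁻¹ *_) (u≡cv i) ⟩
      c⁻¹ * (c * v i)  ≡⟨ sym (*-assoc c⁻¹ c (v i)) ⟩
      c⁻¹ * c * v i    ≡⟨ cong (_* v i) (trans (*-comm c⁻¹ c) cc⁻¹≡1) ⟩
      1# * v i         ≡⟨ *-identityˡ (v i) ⟩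
      v i              ∎)
    where
    open ≡-Reasoning
    c⁻¹≢0 : c⁻¹ ≢ 0#
    c⁻¹≢0 c⁻¹≡0 = 0≢1 (trans (sym (zeroʳ c)) (trans (cong (c *_) (sym c⁻¹≡0)) cc⁻¹≡1))

  Proportional-trans : ∀ {t} {u v w : Vecᶠ F t} → Proportional F u v → Proportional F v w → Proportional F u w
  Proportional-trans {w = w} (c , c≢0 , u≡cv) (d , d≢0 , v≡dw) =
    c * d , (λ cd≡0 → d≢0 (x*y≡0⇒y≡0 c≢0 cd≡0)) ,
    λ i → trans (u≡cv i) (trans (cong (c *_) (v≡dw i)) (sym (*-assoc c d (w i))))

  cross≡0⇒minors≡ : ∀ (u v : V3) → (∀ i → cross u v i ≡ 0#) → ∀ j k → u j * v k ≡ u k * v j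
  cross≡0⇒minors≡ u v uv≡0 0F 0F = refl
  cross≡0⇒minors≡ u v uv≡0 0F 1F = x-y≡0⇒x≡y (uv≡0 2F)
  cross≡0⇒minors≡ u v uv≡0 0F 2F = sym (x-y≡0⇒x≡y (uv≡0 1F))
  cross≡0⇒minors≡ u v uv≡0 1F 0F = sym (x-y≡0⇒x≡y (uv≡0 2F))
  cross≡0⇒minors≡ u v uv≡0 1F 1F = refl
  cross≡0⇒minors≡ u v uv≡0 1F 2F = x-y≡0⇒x≡y (uv≡0 0F)
  cross≡0⇒minors≡ u v uv≡0 2F 0F = x-y≡0⇒x≡y (uv≡0 1F)
  cross≡0⇒minors≡ u v uv≡0 2F 1F = sym (x-y≡0⇒x≡y (uv≡0 0F))
  cross≡0⇒minors≡ u v uv≡0 2F 2F = refl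

  -- With u k ≠ 0 (hence v k ≠ 0), the scale factor is u k / v k.
  cross≡0⇒proportional : ∀ {u v : V3} → NonZeroVec F u → NonZeroVec F v →
    (∀ i → cross u v i ≡ 0#) → Proportional F u v
  cross≡0⇒proportional {u} {v} u≢0 v≢0 uv≡0 with ¬∀⟶∃¬ 3 (λ i → u i ≡ 0#) (λ i → u i ≟ 0#) u≢0
  ... | (k , uₖ≢0) = u k * vₖ⁻¹ , c≢0 , u≡cv
    where
    minors = cross≡0⇒minors≡ u v uv≡0
    swap₂ : ∀ a b c → a * b * c ≡ a * c * b
    swap₂ = solve 3 (λ a b c → a :* b :* c := a :* c :* b) refl
    vₖ≢0 : v k ≢ 0#
    vₖ≢0 vₖ≡0 = v≢0 (λ j → x*y≡0⇒y≡0 uₖ≢0 (trans (sym (minors j k)) (trans (cong (u j *_) vₖ≡0) (zeroʳ (u j)))))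
    vₖ⁻¹ = proj₁ (inverse (v k) vₖ≢0)
    divide : ∀ j → u j ≡ u j * v k * vₖ⁻¹
    divide j = trans (sym (*-identityʳ (u j)))
      (trans (cong (u j *_) (sym (proj₂ (inverse (v k) vₖ≢0)))) (sym (*-assoc (u j) (v k) vₖ⁻¹)))
    c≢0 : u k * vₖ⁻¹ ≢ 0#
    c≢0 c≡0 = uₖ≢0 (trans (divide k) (trans (swap₂ (u k) (v k) vₖ⁻¹) (trans (cong (_* v k) c≡0) (zeroˡ (v k)))))
    u≡cv : ∀ j → u j ≡ u k * vₖ⁻¹ * v j
    u≡cv j = trans (divide j) (trans (cong (_* vₖ⁻¹) (minors j k)) (swap₂ (u k) (v j) vₖ⁻¹))

  isCPHF-fromCoordinates : ∀ {n K} {P : Set} (φ : Fin (suc n) → P → V3) (col : Fin K → P) →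
    Injective _≡_ _≡_ col → (∀ r x → NonZeroVec F (φ r x)) →
    (∀ {x y z} → x ≢ y → y ≢ z → x ≢ z → ∀ {r r′} → r ≢ r′ →
       det (φ r x) (φ r y) (φ r z) ≡ 0# → det (φ r′ x) (φ r′ y) (φ r′ z) ≡ 0# → ⊥) →
    IsCPHF F n (suc n) 3 K (λ r k → φ r (col k))
  isCPHF-fromCoordinates φ col col-inj φ≢0 singular-once = (λ r k → φ≢0 r (col k)) , λ c c-inj →
    allButAtMostOne (λ r → det (φ r (col (c 0F))) (φ r (col (c 1F))) (φ r (col (c 2F))) ≟ 0#)
      (λ r → det≢0⇒linIndep (λ i → φ r (col (c i))))
      (singular-once (distinct c-inj λ ()) (distinct c-inj λ ()) (distinct c-inj λ ()))
    where
    distinct : ∀ {c : Fin 3 → _} → Injective _≡_ _≡_ c → ∀ {i j} → i ≢ j → col (c i) ≢ col (c j)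
    distinct c-inj i≢j eq = i≢j (c-inj (col-inj eq))

  -- Projective planes: the vectors (1, a, b), (0, 1, a), (0, 0, 1) represent each
  -- projective point exactly once.

  element : Fin q → Carrier
  element = Inverse.from card

  ProjIndex : Set
  ProjIndex = ((Fin q × Fin q) ⊎ Fin q) ⊎ Fin 1

  projIndex : Fin (q ℕ.* q ℕ.+ q ℕ.+ 1) ↔ ProjIndex
  projIndex = ↔-trans +↔⊎ (↔-trans +↔⊎ (*↔× ⊎-↔ ↔-refl) ⊎-↔ ↔-refl)

  normalForm : ProjIndex → V3
  normalForm (inj₁ (inj₁ (a , b))) = 1# ∷ element a ∷ element b ∷ []
  normalForm (inj₁ (inj₂ a))       = 0# ∷ 1# ∷ element a ∷ []
  normalForm (inj₂ _)              = 0# ∷ 0# ∷ 1# ∷ []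

  normalForm-nonzero : ∀ i → NonZeroVec F (normalForm i)
  normalForm-nonzero (inj₁ (inj₁ _)) ≡0 = 0≢1 (sym (≡0 0F))
  normalForm-nonzero (inj₁ (inj₂ _)) ≡0 = 0≢1 (sym (≡0 1F))
  normalForm-nonzero (inj₂ _)        ≡0 = 0≢1 (sym (≡0 2F))

  1≢c*0 : ∀ {c} → 1# ≢ c * 0#
  1≢c*0 {c} 1≡c*0 = 0≢1 (sym (trans 1≡c*0 (zeroʳ c)))

  0≢c*1 : ∀ {c} → c ≢ 0# → 0# ≢ c * 1#
  0≢c*1 {c} c≢0 0≡c*1 = c≢0 (trans (sym (*-identityʳ c)) (sym 0≡c*1))

  scaled-element : ∀ {c a b} → 1# ≡ c * 1# → element a ≡ c * element b → a ≡ b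
  scaled-element {c} {b = b} 1≡c*1 eq =
    ↔-from-injective card (trans eq (trans (cong (_* element b) c≡1) (*-identityˡ (element b))))
    where
    c≡1 : c ≡ 1#
    c≡1 = trans (sym (*-identityʳ c)) (sym 1≡c*1)

  normalForm-injective : ∀ i j → Proportional F (normalForm i) (normalForm j) → i ≡ j
  normalForm-injective (inj₁ (inj₁ _)) (inj₁ (inj₁ _)) (_ , _ , h) =
    cong (inj₁ ∘′ inj₁) (cong₂ _,_ (scaled-element (h 0F) (h 1F)) (scaled-element (h 0F) (h 2F)))
  normalForm-injective (inj₁ (inj₁ _)) (inj₁ (inj₂ _)) (_ , _ , h)   = ⊥-elim (1≢c*0 (h 0F))
  normalForm-injective (inj₁ (inj₁ _)) (inj₂ _)        (_ , _ , h)   = ⊥-elim (1≢c*0 (h 0F))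
  normalForm-injective (inj₁ (inj₂ _)) (inj₁ (inj₁ _)) (_ , c≢0 , h) = ⊥-elim (0≢c*1 c≢0 (h 0F))
  normalForm-injective (inj₁ (inj₂ _)) (inj₁ (inj₂ _)) (_ , _ , h)   = cong (inj₁ ∘′ inj₂) (scaled-element (h 1F) (h 2F))
  normalForm-injective (inj₁ (inj₂ _)) (inj₂ _)        (_ , _ , h)   = ⊥-elim (1≢c*0 (h 1F))
  normalForm-injective (inj₂ _)        (inj₁ (inj₁ _)) (_ , c≢0 , h) = ⊥-elim (0≢c*1 c≢0 (h 0F))
  normalForm-injective (inj₂ _)        (inj₁ (inj₂ _)) (_ , c≢0 , h) = ⊥-elim (0≢c*1 c≢0 (h 1F))
  normalForm-injective (inj₂ 0F)       (inj₂ 0F)       _             = refl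

  projPoint : ∀ {P} → DesarguesianProjPlane F P → Fin (q ℕ.* q ℕ.+ q ℕ.+ 1) → P
  projPoint π k = proj₁ (surjective π (normalForm i) (normalForm-nonzero i))
    where i = Inverse.to projIndex k

  projPoint-injective : ∀ {P} (π : DesarguesianProjPlane F P) → Injective _≡_ _≡_ (projPoint π)
  projPoint-injective π {k} {l} eq = ↔-to-injective projIndex (normalForm-injective _ _
    (Proportional-trans (proportional k)
      (Proportional-sym (subst (Proportional F _ ∘′ coord π) (sym eq) (proportional l)))))
    where
    proportional : ∀ k → Proportional F (normalForm (Inverse.to projIndex k)) (coord π (projPoint π k))
    proportional k = proj₂ (surjective π _ (normalForm-nonzero (Inverse.to projIndex k)))

  ProjCollinear : ∀ {P} → DesarguesianProjPlane F P → P → P → P → Set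
  ProjCollinear π x y z = Σ[ a ∈ V3 ] NonZeroVec F a × OnLine π a x × OnLine π a y × OnLine π a z

  det≡0⇒projCollinear : ∀ {P} (π : DesarguesianProjPlane F P) {x y z} → x ≢ y →
    det (coord π x) (coord π y) (coord π z) ≡ 0# → ProjCollinear π x y z
  det≡0⇒projCollinear π {x} {y} x≢y d≡0 =
    cross (coord π x) (coord π y) , line≢0 ,
    det-repeatˡ (coord π x) (coord π y) , det-repeatʳ (coord π x) (coord π y) , d≡0
    where
    line≢0 : NonZeroVec F (cross (coord π x) (coord π y))
    line≢0 line≡0 = x≢y (injective π x y (cross≡0⇒proportional (nonzero π x) (nonzero π y) line≡0))

  orthogovalProj⇒¬bothCollinear : ∀ {P} (π₁ π₂ : DesarguesianProjPlane F P) → OrthogovalProj F π₁ π₂ →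
    ∀ {x y z} → x ≢ y → y ≢ z → x ≢ z → ProjCollinear π₁ x y z → ProjCollinear π₂ x y z → ⊥
  orthogovalProj⇒¬bothCollinear _ _ orth x≢y y≢z x≢z (a , a≢0 , ax , ay , az) (b , b≢0 , bx , by , bz) =
    orth a b a≢0 b≢0 _ _ _ x≢y y≢z x≢z (ax , ay , az , bx , by , bz)

  projectiveCPHF : ∀ {n P} (π : Fin (suc n) → DesarguesianProjPlane F P) → MutOrthProj F (suc n) π →
    CPHF F n (suc n) 3 (q ℕ.* q ℕ.+ q ℕ.+ 1)
  projectiveCPHF π orth = _ , isCPHF-fromCoordinates (λ r → coord (π r)) (projPoint (π 0F)) (projPoint-injective (π 0F))
    (λ r → nonzero (π r))
    (λ x≢y y≢z x≢z {r} {r′} r≢r′ d≡0 d′≡0 →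
      orthogovalProj⇒¬bothCollinear (π r) (π r′) (orth r r′ r≢r′) x≢y y≢z x≢z
      (det≡0⇒projCollinear (π r) x≢y d≡0) (det≡0⇒projCollinear (π r′) x≢y d′≡0))

  lift : V2 → V3
  lift u = u 0F ∷ u 1F ∷ 1# ∷ []

  lift-nonzero : ∀ u → NonZeroVec F (lift u)
  lift-nonzero u ≡0 = 0≢1 (sym (≡0 2F))

  OnCommonLine : V2 → V2 → V2 → Set
  OnCommonLine u v w = Σ[ a ∈ V2 ] NonZeroVec F a × Σ[ c ∈ Carrier ] dot F a u ≡ c × dot F a v ≡ c × dot F a w ≡ c

  -- The line through u and v is a · p = c, where (a₀, a₁, -c) = lift u × lift v.
  lineThrough : V2 → V2 → V2
  lineThrough u v = cross (lift u) (lift v) 0F ∷ cross (lift u) (lift v) 1F ∷ []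

  det-lift≡0⇒onLineThrough : ∀ u v p → det (lift u) (lift v) (lift p) ≡ 0# →
    dot F (lineThrough u v) p ≡ - cross (lift u) (lift v) 2F
  det-lift≡0⇒onLineThrough u v p d≡0 = inverseˡ-unique _ _ (trans (sym (reassoc _ _ _)) d≡0)
    where
    reassoc : ∀ a b c → a + (b + (c * 1# + 0#)) ≡ (a + (b + 0#)) + c
    reassoc = solve 3 (λ a b c → a :+ (b :+ (c :* con 1 :+ con 0)) := (a :+ (b :+ con 0)) :+ c) refl

  lineThrough≡0⇒≡ : ∀ u v → (∀ i → lineThrough u v i ≡ 0#) → ∀ i → u i ≡ v i
  lineThrough≡0⇒≡ u v line≡0 0F = trans (sym (*-identityʳ (u 0F)))
    (trans (sym (x-y≡0⇒x≡y (line≡0 1F))) (*-identityˡ (v 0F)))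
  lineThrough≡0⇒≡ u v line≡0 1F = trans (sym (*-identityʳ (u 1F)))
    (trans (x-y≡0⇒x≡y (line≡0 0F)) (*-identityˡ (v 1F)))

  coincident⇒onCommonLine : ∀ {u v w} → (∀ i → u i ≡ v i) → (∀ i → u i ≡ w i) → OnCommonLine u v w
  coincident⇒onCommonLine {u} u≡v u≡w = a , (λ a≡0 → 0≢1 (sym (a≡0 0F))) , dot F a u , refl ,
    sym (dot-congʳ a u≡v) , sym (dot-congʳ a u≡w)
    where
    a : V2
    a = 1# ∷ 0# ∷ []

  det-lift≡0⇒onCommonLine : ∀ u v w → det (lift u) (lift v) (lift w) ≡ 0# → OnCommonLine u v w
  det-lift≡0⇒onCommonLine u v w d≡0 with all? (λ i → lineThrough u v i ≟ 0#)
  ... | no uv≢0 = lineThrough u v , uv≢0 , _ ,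
        det-lift≡0⇒onLineThrough u v u (det-repeatˡ (lift u) (lift v)) ,
        det-lift≡0⇒onLineThrough u v v (det-repeatʳ (lift u) (lift v)) ,
        det-lift≡0⇒onLineThrough u v w d≡0
  ... | yes uv≡0 with all? (λ i → lineThrough u w i ≟ 0#)
  ...   | no uw≢0 = lineThrough u w , uw≢0 , _ , onU ,
          trans (sym (dot-congʳ (lineThrough u w) (lineThrough≡0⇒≡ u v uv≡0))) onU ,
          det-lift≡0⇒onLineThrough u w w (det-repeatʳ (lift u) (lift w))
    where onU = det-lift≡0⇒onLineThrough u w u (det-repeatˡ (lift u) (lift w))
  ...   | yes uw≡0 = coincident⇒onCommonLine (lineThrough≡0⇒≡ u v uv≡0) (lineThrough≡0⇒≡ u w uw≡0)

  grid : Fin q × Fin q → V2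
  grid (a , b) = element a ∷ element b ∷ []

  grid-injective : Injective _≡_ _≡_ grid
  grid-injective {a , b} {a′ , b′} eq =
    cong₂ _,_ (↔-from-injective card (cong (λ p → p 0F) eq)) (↔-from-injective card (cong (λ p → p 1F) eq))

  affPoint : ∀ {P} → DesarguesianAffPlane F P → Fin (q ℕ.* q) → P
  affPoint π k = Inverse.from (affCoord π) (grid (Inverse.to *↔× k))

  affPoint-injective : ∀ {P} (π : DesarguesianAffPlane F P) → Injective _≡_ _≡_ (affPoint π)
  affPoint-injective π eq = ↔-to-injective *↔× (grid-injective (↔-from-injective (affCoord π) eq))

  orthogovalAff⇒¬bothOnLine : ∀ {P} (π₁ π₂ : DesarguesianAffPlane F P) → OrthogovalAff F π₁ π₂ →
    ∀ {x y z} → x ≢ y → y ≢ z → x ≢ z →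
    let φ₁ = Inverse.to (affCoord π₁); φ₂ = Inverse.to (affCoord π₂) in
    OnCommonLine (φ₁ x) (φ₁ y) (φ₁ z) → OnCommonLine (φ₂ x) (φ₂ y) (φ₂ z) → ⊥
  orthogovalAff⇒¬bothOnLine _ _ orth x≢y y≢z x≢z (a , a≢0 , c , ax , ay , az) (b , b≢0 , d , bx , by , bz) =
    orth a b c d a≢0 b≢0 _ _ _ x≢y y≢z x≢z (ax , ay , az , bx , by , bz)

  affineSCPHF : ∀ {n P} (π : Fin (suc n) → DesarguesianAffPlane F P) → MutOrthAff F (suc n) π →
    SCPHF F n (suc n) 3 (q ℕ.* q)
  affineSCPHF π orth = _ , isCPHF-fromCoordinates (λ r x → lift (ψ r x)) (affPoint (π 0F)) (affPoint-injective (π 0F))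
    (λ r x → lift-nonzero (ψ r x))
    (λ {x} {y} {z} x≢y y≢z x≢z {r} {r′} r≢r′ d≡0 d′≡0 →
      orthogovalAff⇒¬bothOnLine (π r) (π r′) (orth r r′ r≢r′) x≢y y≢z x≢z
      (det-lift≡0⇒onCommonLine (ψ r x) (ψ r y) (ψ r z) d≡0)
      (det-lift≡0⇒onCommonLine (ψ r′ x) (ψ r′ y) (ψ r′ z) d′≡0)) ,
    λ { r k 2F _ ≡0 → 0≢1 (sym ≡0) }
    where
    ψ : ∀ r → _ → V2
    ψ r = Inverse.to (affCoord (π r))

open import Data.Nat using (_+_; _*_)

theorem4p4 : (q : ℕ) (F : FiniteField q) (s : ℕ) → s ≥ 1 →
    ((P : Set) (π : Fin s → DesarguesianProjPlane F P) → MutOrthProj F s π →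
       CPHF F (s ∸ 1) s 3 (q * q + q + 1))
    ×
    ((P : Set) (π : Fin s → DesarguesianAffPlane F P) → MutOrthAff F s π →
       SCPHF F (s ∸ 1) s 3 (q * q))
theorem4p4 q F (suc n) _ = (λ _ → projectiveCPHF F) , (λ _ → affineSCPHF F)
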